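{- Let $(t(n))_{n\ge0}$ be the Thue–Morse sequence ($t(0)=0$, $t(2n)=t(n)$, $t(2n+1)=1-t(n)$). Let $(a(n))_{n\ge0}$ be the increasing enumeration (indexed from $0$) of the odious numbers (nonnegative integers with odd binary digit sum) and $(b(n))_{n\ge0}$ that of the evil numbers (nonnegative integers with even binary digit sum). Then for all $n\ge0$: $$\sum_{k=0}^{b(n)}a(k)=b(n)^2+b(n)+n+1,\qquad \sum_{k=0}^{a(n)}b(k)=a(n)^2+a(n)+n+1,$$ $$\sum_{k=0}^{a(n)}a(k)=a(n)^2+2a(n)-n,\qquad \sum_{k=0}^{b(n)}b(k)=b(n)^2+2b(n)-n.$$ Moreover, for all $n\ge0$, $$\sum_{k:\,a(k)\le n}a(k)=\begin{cases}\frac{n^2}{4}-\frac n4+n\,t(n) & \text{if } n\equiv0\pmod 4,\\ \frac{n^2}{4}+\frac n4-\frac12+t(n) & \text{if } n\equiv1\pmod4,\\ \frac{n^2}{4}-\frac n4-\frac12+(n+1)t(n) & \text{if } n\equiv 2\pmod 4,\\ \frac{n^2}{4}+\frac n4 & \text{if } n\equiv3\pmod4,\end{cases}$$ $$\sum_{k:\,b(k)\le n}b(k)=\begin{cases}\frac{n^2}{4}+\frac{3n}4-n\,t(n) & \text{if } n\equiv0\pmod 4,\\ \frac{n^2}{4}+\frac n4+\frac12-t(n) & \text{if } n\equiv1\pmod4,\\ \frac{n^2}{4}+\frac{3n}4+\frac12-(n+1)t(n) & \text{if } n\equiv 2\pmod 4,\\ \frac{n^2}{4}+\frac n4 & \text{if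 } n\equiv3\pmod4.\end{cases}$$ -}

module Defs where

open import Data.Nat using (ℕ; zero; suc; _+_; _*_; _∸_; _≤_; _<_; _≤?_; _/_; _%_)
open import Data.Product using (_×_; ∃)
open import Relation.Binary.PropositionalEquality using (_≡_)
open import Relation.Nullary using (yes; no)

-- Thue–Morse sequence, by the recurrence t(0)=0, t(2n)=t(n), t(2n+1)=1-t(n).
-- Implemented with fuel (fuel n suffices since n / 2 < n for n ≥ 1).
tFuel : ℕ → ℕ → ℕ
tFuel zero    n = 0
tFuel (suc f) zero = 0
tFuel (suc f) n@(suc _) with n % 2
... | zero  = tFuel f (n / 2)
... | suc _ = 1 ∸ tFuel f (n / 2)

t : ℕ → ℕ
t n = tFuel n n

digitSumFuel : ℕ → ℕ → ℕ
digitSumFuel zero    n = 0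
digitSumFuel (suc f) zero = 0
digitSumFuel (suc f) n@(suc _) = n % 2 + digitSumFuel f (n / 2)

digitSum : ℕ → ℕ
digitSum n = digitSumFuel n n

Odious : ℕ → Set
Odious n = digitSum n % 2 ≡ 1

Evil : ℕ → Set
Evil n = digitSum n % 2 ≡ 0

IsIncreasingEnumeration : (ℕ → Set) → (ℕ → ℕ) → Set
IsIncreasingEnumeration P f =
  (∀ n → f n < f (suc n)) ×
  (∀ n → P (f n)) ×
  (∀ m → P m → ∃ λ k → f k ≡ m)

sumTo : ℕ → (ℕ → ℕ) → ℕ
sumTo zero    f = f 0
sumTo (suc N) f = sumTo N f + f (suc N)

-- Σ_{k : f k ≤ n} f k, for f strictly increasing (so f k ≥ k and only
-- indices k ≤ n can contribute).
sumUpTo : (ℕ → ℕ) → ℕ → ℕ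
sumUpTo f n = sumTo n (λ k → cond (f k) )
  where
  cond : ℕ → ℕ
  cond m with m ≤? n
  ... | yes _ = m
  ... | no  _ = 0

-- Since t(2k) = t(k) and t(2k+1) = 1 - t(k), the k-th odious number is 2k + 1 - t(k) and the k-th
-- evil number is 2k + t(k); an increasing enumeration is unique, so a and b are these sequences.
-- Their prefix sums are k(k+1) plus a prefix sum of 1 - t or of t, and the prefix sums of t are
-- known in closed form: t(0) + ... + t(2q) = q + t(q) and t(0) + ... + t(2q+1) = q + 1.
-- For n = 2m + r the terms a(k) <= n are exactly a(0), ..., a(m), except that for even n the term
-- a(m) drops out when it equals 2m + 1 (likewise for b).  Writing n = 4q + s, each identity then
-- becomes a polynomial identity in q and t(q), linear in t(q).
module Submission where

open import Defs

module FiniteSums where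

  open import Data.Nat.Base using (ℕ; zero; suc; _+_; _*_; _≤_; _<_; z≤n; s≤s)
  open import Data.Nat.Properties
  open import Data.Nat.Tactic.RingSolver using (solve-∀)
  open import Algebra.Properties.CommutativeSemigroup +-commutativeSemigroup using (interchange)
  open import Data.Sum.Base using (_⊎_; inj₁; inj₂)
  open import Relation.Binary.PropositionalEquality
  open import Relation.Nullary using (yes; no; contradiction)

  sumTo-cong : ∀ N {f g : ℕ → ℕ} → (∀ {k} → k ≤ N → f k ≡ g k) → sumTo N f ≡ sumTo N g
  sumTo-cong zero    f≡g = f≡g z≤n
  sumTo-cong (suc N) f≡g = cong₂ _+_ (sumTo-cong N (λ k≤N → f≡g (m≤n⇒m≤1+n k≤N))) (f≡g ≤-refl)

  sumTo-+ : ∀ N (f g : ℕ → ℕ) → sumTo N (λ k → f k + g k) ≡ sumTo N f + sumTo N g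
  sumTo-+ zero    f g = refl
  sumTo-+ (suc N) f g = trans (cong (_+ (f (suc N) + g (suc N))) (sumTo-+ N f g))
    (interchange (sumTo N f) (sumTo N g) (f (suc N)) (g (suc N)))

  sumTo-*ˡ : ∀ N c (f : ℕ → ℕ) → sumTo N (λ k → c * f k) ≡ c * sumTo N f
  sumTo-*ˡ zero    c f = refl
  sumTo-*ˡ (suc N) c f =
    trans (cong (_+ c * f (suc N)) (sumTo-*ˡ N c f)) (sym (*-distribˡ-+ c (sumTo N f) (f (suc N))))

  sumTo-const : ∀ N c → sumTo N (λ _ → c) ≡ suc N * c
  sumTo-const zero    c = sym (+-identityʳ c)
  sumTo-const (suc N) c = trans (cong (_+ c) (sumTo-const N c)) (+-comm (suc N * c) c)

  sumTo-double : ∀ N → sumTo N (λ k → k + k) ≡ N * suc N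
  sumTo-double zero    = refl
  sumTo-double (suc N) = trans (cong (_+ (suc N + suc N)) (sumTo-double N)) (lemma N)
    where
    lemma : ∀ N → N * suc N + (suc N + suc N) ≡ suc N * suc (suc N)
    lemma = solve-∀

  sumTo-vanishing-tail : ∀ {m} N (f : ℕ → ℕ) → m ≤ N → (∀ {k} → m < k → f k ≡ 0) →
                         sumTo N f ≡ sumTo m f
  sumTo-vanishing-tail zero    f z≤n _ = refl
  sumTo-vanishing-tail (suc N) f m≤1+N vanish with m≤n⇒m<n∨m≡n m≤1+N
  ... | inj₁ (s≤s m≤N) =
    trans (cong₂ _+_ (sumTo-vanishing-tail N f m≤N vanish) (vanish (s≤s m≤N))) (+-identityʳ _)
  ... | inj₂ refl      = refl

  sumTo-cong-last : ∀ m {f g : ℕ → ℕ} {d} → (∀ {k} → k < m → f k ≡ g k) → f m + d ≡ g m →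
                    sumTo m f + d ≡ sumTo m g
  sumTo-cong-last zero        _    last = last
  sumTo-cong-last (suc m) {f} init last =
    trans (+-assoc (sumTo m f) (f (suc m)) _) (cong₂ _+_ (sumTo-cong m (λ k≤m → init (s≤s k≤m))) last)

  ≤1-cases : ∀ {x} → x ≤ 1 → x ≡ 0 ⊎ x ≡ 1
  ≤1-cases z≤n       = inj₁ refl
  ≤1-cases (s≤s z≤n) = inj₂ refl

  cutoff : ℕ → ℕ → ℕ
  cutoff n m with m ≤? n
  ... | yes _ = m
  ... | no  _ = 0

  cutoff-≤ : ∀ {n m} → m ≤ n → cutoff n m ≡ m
  cutoff-≤ {n} {m} m≤n with m ≤? n
  ... | yes _  = refl
  ... | no m≰n = contradiction m≤n m≰n

  cutoff-> : ∀ {n m} → n < m → cutoff n m ≡ 0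
  cutoff-> {n} {m} n<m with m ≤? n
  ... | yes m≤n = contradiction m≤n (<⇒≱ n<m)
  ... | no _    = refl

  sumUpTo-const : ∀ n m → sumUpTo (λ _ → m) n ≡ suc n * cutoff n m
  sumUpTo-const n m with m ≤? n
  ... | yes _ = sumTo-const n m
  ... | no  _ = sumTo-const n 0

  -- The threshold test inside sumUpTo is a local function that cannot be named here; it is
  -- reached through constant sequences, for which sumUpTo is an explicit multiple of it.
  sumUpTo-as-sumTo : ∀ f n → sumUpTo f n ≡ sumTo n (λ k → cutoff n (f k))
  sumUpTo-as-sumTo f n = *-cancelˡ-≡ _ _ (suc n) (begin
    suc n * sumUpTo f n
      ≡⟨ trans (sumTo-cong n (λ _ → sumTo-const n _)) (sumTo-*ˡ n (suc n) _) ⟨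
    sumTo n (λ k → sumUpTo (λ _ → f k) n)           ≡⟨ sumTo-cong n (λ {k} _ → sumUpTo-const n (f k)) ⟩
    sumTo n (λ k → suc n * cutoff n (f k))          ≡⟨ sumTo-*ˡ n (suc n) (λ k → cutoff n (f k)) ⟩
    suc n * sumTo n (λ k → cutoff n (f k))          ∎)
    where open ≡-Reasoning

  sumUpTo-cong : ∀ {f g : ℕ → ℕ} → (∀ k → f k ≡ g k) → ∀ n → sumUpTo f n ≡ sumUpTo g n
  sumUpTo-cong {f} {g} f≡g n = begin
    sumUpTo f n                          ≡⟨ sumUpTo-as-sumTo f n ⟩
    sumTo n (λ k → cutoff n (f k))       ≡⟨ sumTo-cong n (λ {k} _ → cong (cutoff n) (f≡g k)) ⟩
    sumTo n (λ k → cutoff n (g k))       ≡⟨ sumUpTo-as-sumTo g n ⟨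
    sumUpTo g n                          ∎
    where open ≡-Reasoning

  -- Doubling is written k + k rather than 2 * k: the embedding +_ : ℕ → ℤ then commutes with it
  -- definitionally, so that the ring solver over ℤ sees through the natural-number arithmetic.
  twicePlus : (ℕ → ℕ) → ℕ → ℕ
  twicePlus e k = e k + (k + k)

  sumTo-twicePlus : ∀ N e → sumTo N (twicePlus e) ≡ sumTo N e + N * suc N
  sumTo-twicePlus N e = trans (sumTo-+ N e (λ k → k + k)) (cong (sumTo N e +_) (sumTo-double N))

  suc-double : ∀ k → suc k + suc k ≡ suc (suc (k + k))
  suc-double k = cong suc (+-suc k k)

  module TwicePlus (e : ℕ → ℕ) (e≤1 : ∀ k → e k ≤ 1) where

    f : ℕ → ℕ
    f = twicePlus e

    double≤ : ∀ k → k + k ≤ f k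
    double≤ k = m≤n+m (k + k) (e k)

    ≤suc-double : ∀ k → f k ≤ suc (k + k)
    ≤suc-double k = +-monoˡ-≤ (k + k) (e≤1 k)

    suc-double<double : ∀ {m k} → m < k → suc (m + m) < k + k
    suc-double<double {m} m<k = ≤-trans (≤-reflexive (sym (suc-double m))) (+-mono-≤ m<k m<k)

    increasing : ∀ k → f k < f (suc k)
    increasing k = <-≤-trans (s≤s (≤suc-double k)) (≤-trans (suc-double<double ≤-refl) (double≤ (suc k)))

    sumUpTo-odd : ∀ m → sumUpTo f (suc (m + m)) ≡ sumTo m f
    sumUpTo-odd m = begin
      sumUpTo f n                                    ≡⟨ sumUpTo-as-sumTo f n ⟩
      sumTo n (λ k → cutoff n (f k))                 ≡⟨ sumTo-vanishing-tail n _ m≤n dropped ⟩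
      sumTo m (λ k → cutoff n (f k))                 ≡⟨ sumTo-cong m kept ⟩
      sumTo m f                                      ∎
      where
      open ≡-Reasoning
      n : ℕ
      n = suc (m + m)
      m≤n : m ≤ n
      m≤n = ≤-trans (m≤m+n m m) (n≤1+n (m + m))
      dropped : ∀ {k} → m < k → cutoff n (f k) ≡ 0
      dropped m<k = cutoff-> (≤-trans (suc-double<double m<k) (double≤ _))
      kept : ∀ {k} → k ≤ m → cutoff n (f k) ≡ f k
      kept k≤m = cutoff-≤ (≤-trans (≤suc-double _) (s≤s (+-mono-≤ k≤m k≤m)))

    sumUpTo-even : ∀ m → sumUpTo f (m + m) + e m * suc (m + m) ≡ sumTo m f
    sumUpTo-even m = begin
      sumUpTo f (m + m) + e m * suc (m + m)                     ≡⟨ cong (_+ e m * suc (m + m)) truncate ⟩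
      sumTo m (λ k → cutoff (m + m) (f k)) + e m * suc (m + m)  ≡⟨ sumTo-cong-last m kept last ⟩
      sumTo m f                                                 ∎
      where
      open ≡-Reasoning
      truncate : sumUpTo f (m + m) ≡ sumTo m (λ k → cutoff (m + m) (f k))
      truncate = trans (sumUpTo-as-sumTo f (m + m)) (sumTo-vanishing-tail (m + m) _ (m≤m+n m m) dropped)
        where
        dropped : ∀ {k} → m < k → cutoff (m + m) (f k) ≡ 0
        dropped m<k = cutoff-> (<-trans (n<1+n _) (≤-trans (suc-double<double m<k) (double≤ _)))
      kept : ∀ {k} → k < m → cutoff (m + m) (f k) ≡ f k
      kept {k} k<m = cutoff-≤ (≤-trans (≤suc-double k) (<⇒≤ (suc-double<double k<m)))
      last : cutoff (m + m) (f m) + e m * suc (m + m) ≡ f m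
      last with ≤1-cases (e≤1 m)
      ... | inj₁ e≡0 rewrite e≡0 = trans (+-identityʳ _) (cutoff-≤ ≤-refl)
      ... | inj₂ e≡1 rewrite e≡1 = trans (cong (_+ (suc (m + m) + 0)) (cutoff-> (n<1+n _))) (+-identityʳ _)

module Enumerations where

  open import Data.Nat.Base using (ℕ; zero; suc; _≤_; _<_; z≤n; s≤s)
  open import Data.Nat.Properties
  open import Data.Product using (_,_; _×_; ∃; proj₁; proj₂)
  open import Data.Sum.Base using (inj₁; inj₂)
  open import Relation.Binary.PropositionalEquality

  increasing⇒monotone : ∀ {f : ℕ → ℕ} → (∀ k → f k < f (suc k)) → ∀ {i j} → i ≤ j → f i ≤ f j
  increasing⇒monotone inc {j = zero}  z≤n = ≤-refl
  increasing⇒monotone inc {j = suc j} i≤1+j with m≤n⇒m<n∨m≡n i≤1+j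
  ... | inj₁ (s≤s i≤j) = ≤-trans (increasing⇒monotone inc i≤j) (<⇒≤ (inc j))
  ... | inj₂ refl      = ≤-refl

  increasing⇒reflects-< : ∀ {f : ℕ → ℕ} → (∀ k → f k < f (suc k)) → ∀ {i j} → f i < f j → i < j
  increasing⇒reflects-< inc fi<fj = ≰⇒> (λ j≤i → <⇒≱ fi<fj (increasing⇒monotone inc j≤i))

  module _ {P : ℕ → Set} {f g : ℕ → ℕ} (enum : IsIncreasingEnumeration P f)
           (g-inc : ∀ k → g k < g (suc k)) (g∈P : ∀ k → P (g k)) where

    private
      f-inc : ∀ k → f k < f (suc k)
      f-inc = proj₁ enum

      f-onto : ∀ m → P m → ∃ λ k → f k ≡ m
      f-onto = proj₂ (proj₂ enum)

    enumeration-index : ∀ n → ∃ λ j → n ≤ j × f j ≡ g n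
    enumeration-index zero with f-onto (g 0) (g∈P 0)
    ... | j , fj≡g0 = j , z≤n , fj≡g0
    enumeration-index (suc n) with enumeration-index n | f-onto (g (suc n)) (g∈P (suc n))
    ... | j , n≤j , fj≡gn | j′ , fj′≡g1+n = j′ , <-≤-trans (s≤s n≤j) j<j′ , fj′≡g1+n
      where
      j<j′ : j < j′
      j<j′ = increasing⇒reflects-< f-inc (subst₂ _<_ (sym fj≡gn) (sym fj′≡g1+n) (g-inc n))

    enumeration-≤ : ∀ n → f n ≤ g n
    enumeration-≤ n with enumeration-index n
    ... | j , n≤j , fj≡gn = ≤-trans (increasing⇒monotone f-inc n≤j) (≤-reflexive fj≡gn)

  enumeration-unique : ∀ {P f g} → IsIncreasingEnumeration P f → IsIncreasingEnumeration P g → ∀ n → f n ≡ g n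
  enumeration-unique ef@(f-inc , f∈P , _) eg@(g-inc , g∈P , _) n =
    ≤-antisym (enumeration-≤ ef g-inc g∈P n) (enumeration-≤ eg f-inc f∈P n)

module ThueMorse where

  open import Data.Nat.Base using (ℕ; zero; suc; _+_; _*_; _∸_; _≤_; _<_; z≤n; s≤s; _/_; _%_)
  open import Data.Nat.Properties
  open import Data.Nat.DivMod
  open import Data.Nat.Tactic.RingSolver using (solve-∀)
  open import Data.Product using (_,_; ∃)
  open import Data.Sum.Base using (_⊎_; inj₁; inj₂)
  open import Relation.Binary.PropositionalEquality
  open import Algebra.Properties.CommutativeSemigroup +-commutativeSemigroup using (xy∙z≈xz∙y)
  open import Relation.Nullary using (contradiction)
  open FiniteSums
  open Enumerations

  %2≤1 : ∀ m → m % 2 ≤ 1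
  %2≤1 m = ≤-pred (m%n<n m 2)

  [1+m]%2≡1∸m%2 : ∀ m → (1 + m) % 2 ≡ 1 ∸ m % 2
  [1+m]%2≡1∸m%2 m with ≤1-cases (%2≤1 m)
  ... | inj₁ m%2≡0 =
    trans (%-distribˡ-+ 1 m 2) (trans (cong (λ r → (1 + r) % 2) m%2≡0) (cong (1 ∸_) (sym m%2≡0)))
  ... | inj₂ m%2≡1 =
    trans (%-distribˡ-+ 1 m 2) (trans (cong (λ r → (1 + r) % 2) m%2≡1) (cong (1 ∸_) (sym m%2≡1)))

  -- Both fuelled recursions read the same binary digits, so no assumption on the fuel is needed.
  digitSumFuel-parity : ∀ f n → digitSumFuel f n % 2 ≡ tFuel f n
  digitSumFuel-parity zero    n       = refl
  digitSumFuel-parity (suc f) zero    = refl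
  digitSumFuel-parity (suc f) (suc k) with suc k % 2 | %2≤1 (suc k)
  ... | zero        | _ = digitSumFuel-parity f (suc k / 2)
  ... | suc zero    | _ =
    trans ([1+m]%2≡1∸m%2 (digitSumFuel f (suc k / 2))) (cong (1 ∸_) (digitSumFuel-parity f (suc k / 2)))
  ... | suc (suc _) | s≤s ()

  digitSum-parity : ∀ n → digitSum n % 2 ≡ t n
  digitSum-parity n = digitSumFuel-parity n n

  t≤1 : ∀ n → t n ≤ 1
  t≤1 n = subst (_≤ 1) (digitSum-parity n) (%2≤1 (digitSum n))

  tFuel-zero : ∀ f → tFuel f 0 ≡ 0
  tFuel-zero zero    = refl
  tFuel-zero (suc f) = refl

  half≤ : ∀ k → suc k / 2 ≤ k
  half≤ k = ≤-pred (m/n<m (suc k) 2 (s≤s (s≤s z≤n)))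

  tFuel-irrelevant : ∀ f g n → n ≤ f → n ≤ g → tFuel f n ≡ tFuel g n
  tFuel-irrelevant f       g       zero    _         _         = trans (tFuel-zero f) (sym (tFuel-zero g))
  tFuel-irrelevant (suc f) (suc g) (suc k) (s≤s k≤f) (s≤s k≤g) with suc k % 2
  ... | zero  = tFuel-irrelevant f g (suc k / 2) (≤-trans (half≤ k) k≤f) (≤-trans (half≤ k) k≤g)
  ... | suc _ =
    cong (1 ∸_) (tFuel-irrelevant f g (suc k / 2) (≤-trans (half≤ k) k≤f) (≤-trans (half≤ k) k≤g))

  t-even : ∀ n → n % 2 ≡ 0 → t n ≡ t (n / 2)
  t-even zero    _    = refl
  t-even (suc k) even rewrite even = tFuel-irrelevant k (suc k / 2) (suc k / 2) (half≤ k) ≤-refl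

  t-odd : ∀ n → n % 2 ≡ 1 → t n ≡ 1 ∸ t (n / 2)
  t-odd (suc k) odd rewrite odd = cong (1 ∸_) (tFuel-irrelevant k (suc k / 2) (suc k / 2) (half≤ k) ≤-refl)

  m+m≡m*2 : ∀ m → m + m ≡ m * 2
  m+m≡m*2 = solve-∀

  [m+m]%2≡0 : ∀ m → (m + m) % 2 ≡ 0
  [m+m]%2≡0 m = trans (cong (_% 2) (m+m≡m*2 m)) (m*n%n≡0 m 2)

  [m+m]/2≡m : ∀ m → (m + m) / 2 ≡ m
  [m+m]/2≡m m = trans (cong (_/ 2) (m+m≡m*2 m)) (m*n/n≡m m 2)

  [1+m+m]%2≡1 : ∀ m → suc (m + m) % 2 ≡ 1
  [1+m+m]%2≡1 m = trans (cong (λ x → suc x % 2) (m+m≡m*2 m)) ([m+kn]%n≡m%n 1 m 2)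

  [1+m+m]/2≡m : ∀ m → suc (m + m) / 2 ≡ m
  [1+m+m]/2≡m m = begin
    suc (m + m) / 2          ≡⟨ cong (λ x → suc x / 2) (m+m≡m*2 m) ⟩
    (1 + m * 2) / 2          ≡⟨ +-distrib-/ 1 (m * 2) (subst (λ r → 1 + r < 2) (sym (m*n%n≡0 m 2)) ≤-refl) ⟩
    1 / 2 + m * 2 / 2        ≡⟨ m*n/n≡m m 2 ⟩
    m                        ∎
    where open ≡-Reasoning

  t-double : ∀ m → t (m + m) ≡ t m
  t-double m = trans (t-even (m + m) ([m+m]%2≡0 m)) (cong t ([m+m]/2≡m m))

  t-double+1 : ∀ m → t (suc (m + m)) ≡ 1 ∸ t m
  t-double+1 m = trans (t-odd (suc (m + m)) ([1+m+m]%2≡1 m)) (cong (λ h → 1 ∸ t h) ([1+m+m]/2≡m m))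

  halving : ∀ {m e} → m % 2 ≡ e → m ≡ e + (m / 2 + m / 2)
  halving {m} m%2≡e = trans (m≡m%n+[m/n]*n m 2) (cong₂ _+_ m%2≡e (sym (m+m≡m*2 (m / 2))))

  nthOdious : ℕ → ℕ
  nthOdious = twicePlus (λ k → 1 ∸ t k)

  nthEvil : ℕ → ℕ
  nthEvil = twicePlus t

  1∸t≤1 : ∀ k → 1 ∸ t k ≤ 1
  1∸t≤1 k = m∸n≤m 1 (t k)

  t-nthOdious : ∀ k → t (nthOdious k) ≡ 1
  t-nthOdious k with ≤1-cases (t≤1 k)
  ... | inj₁ tk≡0 rewrite tk≡0 = trans (t-double+1 k) (cong (1 ∸_) tk≡0)
  ... | inj₂ tk≡1 rewrite tk≡1 = trans (t-double k) tk≡1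

  t-nthEvil : ∀ k → t (nthEvil k) ≡ 0
  t-nthEvil k with ≤1-cases (t≤1 k)
  ... | inj₁ tk≡0 rewrite tk≡0 = trans (t-double k) tk≡0
  ... | inj₂ tk≡1 rewrite tk≡1 = trans (t-double+1 k) (cong (1 ∸_) tk≡1)

  nthOdious-or-nthEvil : ∀ m → m ≡ nthOdious (m / 2) ⊎ m ≡ nthEvil (m / 2)
  nthOdious-or-nthEvil m with ≤1-cases (%2≤1 m) | ≤1-cases (t≤1 (m / 2))
  ... | inj₁ r≡0 | inj₁ u≡0 = inj₂ (halving (trans r≡0 (sym u≡0)))
  ... | inj₁ r≡0 | inj₂ u≡1 = inj₁ (halving (trans r≡0 (cong (1 ∸_) (sym u≡1))))
  ... | inj₂ r≡1 | inj₁ u≡0 = inj₁ (halving (trans r≡1 (cong (1 ∸_) (sym u≡0))))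
  ... | inj₂ r≡1 | inj₂ u≡1 = inj₂ (halving (trans r≡1 (sym u≡1)))

  nthOdious-enumerates : IsIncreasingEnumeration Odious nthOdious
  nthOdious-enumerates = TwicePlus.increasing (λ k → 1 ∸ t k) 1∸t≤1
                       , (λ k → trans (digitSum-parity (nthOdious k)) (t-nthOdious k))
                       , onto
    where
    onto : ∀ m → Odious m → ∃ λ k → nthOdious k ≡ m
    onto m odious with nthOdious-or-nthEvil m
    ... | inj₁ m≡ = m / 2 , sym m≡
    ... | inj₂ m≡ = contradiction (trans (sym (t-nthEvil (m / 2))) (trans (cong t (sym m≡)) t≡1)) 0≢1+n
      where
      t≡1 : t m ≡ 1
      t≡1 = trans (sym (digitSum-parity m)) odious

  nthEvil-enumerates : IsIncreasingEnumeration Evil nthEvil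
  nthEvil-enumerates = TwicePlus.increasing t t≤1
                     , (λ k → trans (digitSum-parity (nthEvil k)) (t-nthEvil k))
                     , onto
    where
    onto : ∀ m → Evil m → ∃ λ k → nthEvil k ≡ m
    onto m evil with nthOdious-or-nthEvil m
    ... | inj₁ m≡ = contradiction (trans (sym (t-nthOdious (m / 2))) (trans (cong t (sym m≡)) t≡0)) 1+n≢0
      where
      t≡0 : t m ≡ 0
      t≡0 = trans (sym (digitSum-parity m)) evil
    ... | inj₂ m≡ = m / 2 , sym m≡

  odious-enumeration : ∀ {a} → IsIncreasingEnumeration Odious a → ∀ k → a k ≡ nthOdious k
  odious-enumeration ea = enumeration-unique ea nthOdious-enumerates

  evil-enumeration : ∀ {b} → IsIncreasingEnumeration Evil b → ∀ k → b k ≡ nthEvil k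
  evil-enumeration eb = enumeration-unique eb nthEvil-enumerates

  sumTo-t-double : ∀ q → sumTo (q + q) t ≡ q + t q
  sumTo-t-double+1 : ∀ q → sumTo (suc (q + q)) t ≡ suc q

  sumTo-t-double zero    = refl
  sumTo-t-double (suc q) = begin
    sumTo (suc q + suc q) t                         ≡⟨ cong (λ n → sumTo n t) (suc-double q) ⟩
    sumTo (suc (q + q)) t + t (suc (suc (q + q)))   ≡⟨ cong₂ _+_ (sumTo-t-double+1 q) t-2+2q ⟩
    suc q + t (suc q)                               ∎
    where
    open ≡-Reasoning
    t-2+2q : t (suc (suc (q + q))) ≡ t (suc q)
    t-2+2q = trans (cong t (sym (suc-double q))) (t-double (suc q))

  sumTo-t-double+1 q = begin
    sumTo (q + q) t + t (suc (q + q))    ≡⟨ cong₂ _+_ (sumTo-t-double q) (t-double+1 q) ⟩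
    q + t q + (1 ∸ t q)                  ≡⟨ +-assoc q (t q) (1 ∸ t q) ⟩
    q + (t q + (1 ∸ t q))                ≡⟨ cong (q +_) (m+[n∸m]≡n (t≤1 q)) ⟩
    q + 1                                ≡⟨ +-comm q 1 ⟩
    suc q                                ∎
    where open ≡-Reasoning

  sumTo-t-nthEvil : ∀ n → sumTo (nthEvil n) t ≡ n + t n
  sumTo-t-nthEvil n with ≤1-cases (t≤1 n)
  ... | inj₁ tn≡0 rewrite tn≡0 = trans (sumTo-t-double n) (cong (n +_) tn≡0)
  ... | inj₂ tn≡1 rewrite tn≡1 = trans (sumTo-t-double+1 n) (+-comm 1 n)

  sumTo-t-nthOdious : ∀ n → sumTo (nthOdious n) t ≡ suc n
  sumTo-t-nthOdious n with ≤1-cases (t≤1 n)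
  ... | inj₁ tn≡0 rewrite tn≡0 = sumTo-t-double+1 n
  ... | inj₂ tn≡1 rewrite tn≡1 = trans (sumTo-t-double n) (trans (cong (n +_) tn≡1) (+-comm n 1))

  sumTo-nthOdious : ∀ N → sumTo N nthOdious + sumTo N t ≡ suc N * suc N
  sumTo-nthOdious N = begin
    sumTo N nthOdious + sumTo N t            ≡⟨ cong (_+ sumTo N t) (sumTo-twicePlus N (λ k → 1 ∸ t k)) ⟩
    sumTo N (λ k → 1 ∸ t k) + N * suc N + sumTo N t
                                             ≡⟨ xy∙z≈xz∙y (sumTo N (λ k → 1 ∸ t k)) (N * suc N) (sumTo N t) ⟩
    sumTo N (λ k → 1 ∸ t k) + sumTo N t + N * suc N
                                             ≡⟨ cong (_+ N * suc N) complement ⟩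
    suc N + N * suc N                        ∎
    where
    open ≡-Reasoning
    complement : sumTo N (λ k → 1 ∸ t k) + sumTo N t ≡ suc N
    complement = begin
      sumTo N (λ k → 1 ∸ t k) + sumTo N t        ≡⟨ sumTo-+ N (λ k → 1 ∸ t k) t ⟨
      sumTo N (λ k → 1 ∸ t k + t k)              ≡⟨ sumTo-cong N (λ {k} _ → m∸n+n≡m (t≤1 k)) ⟩
      sumTo N (λ _ → 1)                          ≡⟨ sumTo-const N 1 ⟩
      suc N * 1                                  ≡⟨ *-identityʳ (suc N) ⟩
      suc N                                      ∎

  sumTo-nthOdious-upTo-nthEvil : ∀ n → let B = nthEvil n in sumTo B nthOdious ≡ B * B + B + n + 1
  sumTo-nthOdious-upTo-nthEvil n = +-cancelʳ-≡ (n + t n) _ _ (begin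
    sumTo B nthOdious + (n + t n)          ≡⟨ cong (sumTo B nthOdious +_) (sumTo-t-nthEvil n) ⟨
    sumTo B nthOdious + sumTo B t          ≡⟨ sumTo-nthOdious B ⟩
    suc B * suc B                          ≡⟨ square (t n) n ⟩
    B * B + B + n + 1 + (n + t n)          ∎)
    where
    open ≡-Reasoning
    B : ℕ
    B = nthEvil n
    square : ∀ w n → let B = w + (n + n) in suc B * suc B ≡ B * B + B + n + 1 + (n + w)
    square = solve-∀

  sumTo-nthEvil-upTo-nthOdious : ∀ n → let A = nthOdious n in sumTo A nthEvil ≡ A * A + A + n + 1
  sumTo-nthEvil-upTo-nthOdious n = begin
    sumTo A nthEvil                        ≡⟨ sumTo-twicePlus A t ⟩
    sumTo A t + A * suc A                  ≡⟨ cong (_+ A * suc A) (sumTo-t-nthOdious n) ⟩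
    suc n + A * suc A                      ≡⟨ rearrange A n ⟩
    A * A + A + n + 1                      ∎
    where
    open ≡-Reasoning
    A : ℕ
    A = nthOdious n
    rearrange : ∀ A n → suc n + A * suc A ≡ A * A + A + n + 1
    rearrange = solve-∀

  sumTo-nthOdious-upTo-nthOdious : ∀ n → let A = nthOdious n in sumTo A nthOdious + n ≡ A * A + 2 * A
  sumTo-nthOdious-upTo-nthOdious n = +-cancelʳ-≡ 1 _ _ (begin
    sumTo A nthOdious + n + 1              ≡⟨ +-assoc (sumTo A nthOdious) n 1 ⟩
    sumTo A nthOdious + (n + 1)            ≡⟨ cong (sumTo A nthOdious +_) (+-comm n 1) ⟩
    sumTo A nthOdious + suc n              ≡⟨ cong (sumTo A nthOdious +_) (sumTo-t-nthOdious n) ⟨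
    sumTo A nthOdious + sumTo A t          ≡⟨ sumTo-nthOdious A ⟩
    suc A * suc A                          ≡⟨ square A ⟩
    A * A + 2 * A + 1                      ∎)
    where
    open ≡-Reasoning
    A : ℕ
    A = nthOdious n
    square : ∀ A → suc A * suc A ≡ A * A + 2 * A + 1
    square = solve-∀

  sumTo-nthEvil-upTo-nthEvil : ∀ n → let B = nthEvil n in sumTo B nthEvil + n ≡ B * B + 2 * B
  sumTo-nthEvil-upTo-nthEvil n = begin
    sumTo B nthEvil + n                    ≡⟨ cong (_+ n) (sumTo-twicePlus B t) ⟩
    sumTo B t + B * suc B + n              ≡⟨ cong (λ T → T + B * suc B + n) (sumTo-t-nthEvil n) ⟩
    n + t n + B * suc B + n                ≡⟨ rearrange (t n) n ⟩
    B * B + 2 * B                          ∎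
    where
    open ≡-Reasoning
    B : ℕ
    B = nthEvil n
    rearrange : ∀ w n → let B = w + (n + n) in n + w + B * suc B + n ≡ B * B + 2 * B
    rearrange = solve-∀

open import Data.Nat.Base as ℕ using (ℕ; suc; _%_)
open import Data.Nat.DivMod using (m≡m%n+[m/n]*n)
open import Data.Nat.Tactic.RingSolver using (solve-∀)
open import Data.Integer.Base using (+_; 1ℤ; _+_; _-_; _*_)
open import Data.Integer.Properties using (pos-*)
import Data.Integer.Tactic.RingSolver as ℤ-Solver
open import Data.List.Base using (_∷_; [])
open import Data.Product using (_×_; _,_; ∃)
open import Function.Base using (_∘_)
open import Relation.Binary.PropositionalEquality
open FiniteSums
open Enumerations
open ThueMorse

+-moved : ∀ {x y z} → x ℕ.+ y ≡ z → + x ≡ + z - + y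
+-moved {x} {y} x+y≡z = trans (cancel (+ x) (+ y)) (cong (_- + y) (cong +_ x+y≡z))
  where
  cancel : ∀ X Y → X ≡ X + Y - Y
  cancel = ℤ-Solver.solve-∀

+[1∸x] : ∀ {x} → x ℕ.≤ 1 → + (1 ℕ.∸ x) ≡ 1ℤ - + x
+[1∸x] ℕ.z≤n         = refl
+[1∸x] (ℕ.s≤s ℕ.z≤n) = refl

tℤ-double+1 : ∀ q → + t (suc (q ℕ.+ q)) ≡ 1ℤ - + t q
tℤ-double+1 q = trans (cong +_ (t-double+1 q)) (+[1∸x] (t≤1 q))

sumUpTo-nthOdious-even : ∀ m → let M = + m in
  + sumUpTo nthOdious (m ℕ.+ m) ≡ (1ℤ + M) * (1ℤ + M) - + sumTo m t - (1ℤ - + t m) * (1ℤ + (M + M))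
sumUpTo-nthOdious-even m = begin
  + sumUpTo nthOdious (m ℕ.+ m)
    ≡⟨ +-moved (TwicePlus.sumUpTo-even (λ k → 1 ℕ.∸ t k) 1∸t≤1 m) ⟩
  + sumTo m nthOdious - + ((1 ℕ.∸ t m) ℕ.* suc (m ℕ.+ m))
    ≡⟨ cong₂ _-_ (+-moved (sumTo-nthOdious m)) (pos-* (1 ℕ.∸ t m) (suc (m ℕ.+ m))) ⟩
  + (suc m ℕ.* suc m) - + sumTo m t - + (1 ℕ.∸ t m) * (1ℤ + (+ m + + m))
    ≡⟨ cong₂ (λ S c → S - + sumTo m t - c * (1ℤ + (+ m + + m))) (pos-* (suc m) (suc m)) (+[1∸x] (t≤1 m)) ⟩
  (1ℤ + + m) * (1ℤ + + m) - + sumTo m t - (1ℤ - + t m) * (1ℤ + (+ m + + m))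
    ∎
  where open ≡-Reasoning

sumUpTo-nthOdious-odd : ∀ m → let M = + m in
  + sumUpTo nthOdious (suc (m ℕ.+ m)) ≡ (1ℤ + M) * (1ℤ + M) - + sumTo m t
sumUpTo-nthOdious-odd m = begin
  + sumUpTo nthOdious (suc (m ℕ.+ m))       ≡⟨ cong +_ (TwicePlus.sumUpTo-odd (λ k → 1 ℕ.∸ t k) 1∸t≤1 m) ⟩
  + sumTo m nthOdious                       ≡⟨ +-moved (sumTo-nthOdious m) ⟩
  + (suc m ℕ.* suc m) - + sumTo m t         ≡⟨ cong (_- + sumTo m t) (pos-* (suc m) (suc m)) ⟩
  (1ℤ + + m) * (1ℤ + + m) - + sumTo m t     ∎
  where open ≡-Reasoning

sumUpTo-nthEvil-even : ∀ m → let M = + m in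
  + sumUpTo nthEvil (m ℕ.+ m) ≡ + sumTo m t + M * (1ℤ + M) - + t m * (1ℤ + (M + M))
sumUpTo-nthEvil-even m = begin
  + sumUpTo nthEvil (m ℕ.+ m)
    ≡⟨ +-moved (TwicePlus.sumUpTo-even t t≤1 m) ⟩
  + sumTo m nthEvil - + (t m ℕ.* suc (m ℕ.+ m))
    ≡⟨ cong₂ _-_ (cong +_ (sumTo-twicePlus m t)) (pos-* (t m) (suc (m ℕ.+ m))) ⟩
  + sumTo m t + + (m ℕ.* suc m) - + t m * (1ℤ + (+ m + + m))
    ≡⟨ cong (λ P → + sumTo m t + P - + t m * (1ℤ + (+ m + + m))) (pos-* m (suc m)) ⟩
  + sumTo m t + + m * (1ℤ + + m) - + t m * (1ℤ + (+ m + + m))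
    ∎
  where open ≡-Reasoning

sumUpTo-nthEvil-odd : ∀ m → let M = + m in
  + sumUpTo nthEvil (suc (m ℕ.+ m)) ≡ + sumTo m t + M * (1ℤ + M)
sumUpTo-nthEvil-odd m = begin
  + sumUpTo nthEvil (suc (m ℕ.+ m))         ≡⟨ cong +_ (trans (TwicePlus.sumUpTo-odd t t≤1 m) (sumTo-twicePlus m t)) ⟩
  + sumTo m t + + (m ℕ.* suc m)             ≡⟨ cong (λ P → + sumTo m t + P) (pos-* m (suc m)) ⟩
  + sumTo m t + + m * (1ℤ + + m)            ∎
  where open ≡-Reasoning

quotient-by-4 : ∀ {n s} → n % 4 ≡ s → n ≡ s ℕ.+ n ℕ./ 4 ℕ.* 4
quotient-by-4 {n} r = trans (m≡m%n+[m/n]*n n 4) (cong (ℕ._+ n ℕ./ 4 ℕ.* 4) r)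

4q-form : ∀ {n} → n % 4 ≡ 0 → ∃ λ q → n ≡ (q ℕ.+ q) ℕ.+ (q ℕ.+ q)
4q-form {n} r = n ℕ./ 4 , trans (quotient-by-4 r) (form (n ℕ./ 4))
  where
  form : ∀ q → 0 ℕ.+ q ℕ.* 4 ≡ (q ℕ.+ q) ℕ.+ (q ℕ.+ q)
  form = solve-∀

4q+1-form : ∀ {n} → n % 4 ≡ 1 → ∃ λ q → n ≡ suc ((q ℕ.+ q) ℕ.+ (q ℕ.+ q))
4q+1-form {n} r = n ℕ./ 4 , trans (quotient-by-4 r) (form (n ℕ./ 4))
  where
  form : ∀ q → 1 ℕ.+ q ℕ.* 4 ≡ suc ((q ℕ.+ q) ℕ.+ (q ℕ.+ q))
  form = solve-∀

4q+2-form : ∀ {n} → n % 4 ≡ 2 → ∃ λ q → n ≡ suc (q ℕ.+ q) ℕ.+ suc (q ℕ.+ q)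
4q+2-form {n} r = n ℕ./ 4 , trans (quotient-by-4 r) (form (n ℕ./ 4))
  where
  form : ∀ q → 2 ℕ.+ q ℕ.* 4 ≡ suc (q ℕ.+ q) ℕ.+ suc (q ℕ.+ q)
  form = solve-∀

4q+3-form : ∀ {n} → n % 4 ≡ 3 → ∃ λ q → n ≡ suc (suc (q ℕ.+ q) ℕ.+ suc (q ℕ.+ q))
4q+3-form {n} r = n ℕ./ 4 , trans (quotient-by-4 r) (form (n ℕ./ 4))
  where
  form : ∀ q → 3 ℕ.+ q ℕ.* 4 ≡ suc (suc (q ℕ.+ q) ℕ.+ suc (q ℕ.+ q))
  form = solve-∀

-- In each case the hypotheses of `identity` only substitute the closed forms of the sums of t
-- and of the values of t; after matching them the goal is a ring identity in q and t(q).
sumUpTo-nthOdious-4q : ∀ n → n % 4 ≡ 0 →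
  + 4 * + sumUpTo nthOdious n ≡ + n * + n - + n + + 4 * + n * + t n
sumUpTo-nthOdious-4q n r with 4q-form {n} r
... | q , refl = identity (+ q) (+ t q) (sumUpTo-nthOdious-even (q ℕ.+ q)) (cong +_ (sumTo-t-double q))
                   (cong +_ (t-double q)) (cong +_ (trans (t-double (q ℕ.+ q)) (t-double q)))
  where
  identity : ∀ Q U {X T w ν} → let M = Q + Q ; N = M + M in
    X ≡ (1ℤ + M) * (1ℤ + M) - T - (1ℤ - w) * (1ℤ + (M + M)) → T ≡ Q + U → w ≡ U → ν ≡ U →
    + 4 * X ≡ N * N - N + + 4 * N * ν
  identity Q U refl refl refl refl = ℤ-Solver.solve (Q ∷ U ∷ [])

sumUpTo-nthOdious-4q+1 : ∀ n → n % 4 ≡ 1 →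
  + 4 * + sumUpTo nthOdious n ≡ + n * + n + + n - + 2 + + 4 * + t n
sumUpTo-nthOdious-4q+1 n r with 4q+1-form {n} r
... | q , refl = identity (+ q) (+ t q) (sumUpTo-nthOdious-odd (q ℕ.+ q)) (cong +_ (sumTo-t-double q))
                   (trans (tℤ-double+1 (q ℕ.+ q)) (cong (1ℤ -_) (cong +_ (t-double q))))
  where
  identity : ∀ Q U {X T ν} → let M = Q + Q ; N = 1ℤ + (M + M) in
    X ≡ (1ℤ + M) * (1ℤ + M) - T → T ≡ Q + U → ν ≡ 1ℤ - U →
    + 4 * X ≡ N * N + N - + 2 + + 4 * ν
  identity Q U refl refl refl = ℤ-Solver.solve (Q ∷ U ∷ [])

sumUpTo-nthOdious-4q+2 : ∀ n → n % 4 ≡ 2 →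
  + 4 * + sumUpTo nthOdious n ≡ + n * + n - + n - + 2 + + 4 * (+ n + + 1) * + t n
sumUpTo-nthOdious-4q+2 n r with 4q+2-form {n} r
... | q , refl = identity (+ q) (+ t q) (sumUpTo-nthOdious-even (suc (q ℕ.+ q))) (cong +_ (sumTo-t-double+1 q))
                   (tℤ-double+1 q) (trans (cong +_ (t-double (suc (q ℕ.+ q)))) (tℤ-double+1 q))
  where
  identity : ∀ Q U {X T w ν} → let M = 1ℤ + (Q + Q) ; N = M + M in
    X ≡ (1ℤ + M) * (1ℤ + M) - T - (1ℤ - w) * (1ℤ + (M + M)) → T ≡ 1ℤ + Q → w ≡ 1ℤ - U → ν ≡ 1ℤ - U →
    + 4 * X ≡ N * N - N - + 2 + + 4 * (N + + 1) * ν
  identity Q U refl refl refl refl = ℤ-Solver.solve (Q ∷ U ∷ [])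

sumUpTo-nthOdious-4q+3 : ∀ n → n % 4 ≡ 3 →
  + 4 * + sumUpTo nthOdious n ≡ + n * + n + + n
sumUpTo-nthOdious-4q+3 n r with 4q+3-form {n} r
... | q , refl = identity (+ q) (sumUpTo-nthOdious-odd (suc (q ℕ.+ q))) (cong +_ (sumTo-t-double+1 q))
  where
  identity : ∀ Q {X T} → let M = 1ℤ + (Q + Q) ; N = 1ℤ + (M + M) in
    X ≡ (1ℤ + M) * (1ℤ + M) - T → T ≡ 1ℤ + Q →
    + 4 * X ≡ N * N + N
  identity Q refl refl = ℤ-Solver.solve (Q ∷ [])

sumUpTo-nthEvil-4q : ∀ n → n % 4 ≡ 0 →
  + 4 * + sumUpTo nthEvil n ≡ + n * + n + + 3 * + n - + 4 * + n * + t n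
sumUpTo-nthEvil-4q n r with 4q-form {n} r
... | q , refl = identity (+ q) (+ t q) (sumUpTo-nthEvil-even (q ℕ.+ q)) (cong +_ (sumTo-t-double q))
                   (cong +_ (t-double q)) (cong +_ (trans (t-double (q ℕ.+ q)) (t-double q)))
  where
  identity : ∀ Q U {X T w ν} → let M = Q + Q ; N = M + M in
    X ≡ T + M * (1ℤ + M) - w * (1ℤ + (M + M)) → T ≡ Q + U → w ≡ U → ν ≡ U →
    + 4 * X ≡ N * N + + 3 * N - + 4 * N * ν
  identity Q U refl refl refl refl = ℤ-Solver.solve (Q ∷ U ∷ [])

sumUpTo-nthEvil-4q+1 : ∀ n → n % 4 ≡ 1 →
  + 4 * + sumUpTo nthEvil n ≡ + n * + n + + n + + 2 - + 4 * + t n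
sumUpTo-nthEvil-4q+1 n r with 4q+1-form {n} r
... | q , refl = identity (+ q) (+ t q) (sumUpTo-nthEvil-odd (q ℕ.+ q)) (cong +_ (sumTo-t-double q))
                   (trans (tℤ-double+1 (q ℕ.+ q)) (cong (1ℤ -_) (cong +_ (t-double q))))
  where
  identity : ∀ Q U {X T ν} → let M = Q + Q ; N = 1ℤ + (M + M) in
    X ≡ T + M * (1ℤ + M) → T ≡ Q + U → ν ≡ 1ℤ - U →
    + 4 * X ≡ N * N + N + + 2 - + 4 * ν
  identity Q U refl refl refl = ℤ-Solver.solve (Q ∷ U ∷ [])

sumUpTo-nthEvil-4q+2 : ∀ n → n % 4 ≡ 2 →
  + 4 * + sumUpTo nthEvil n ≡ + n * + n + + 3 * + n + + 2 - + 4 * (+ n + + 1) * + t n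
sumUpTo-nthEvil-4q+2 n r with 4q+2-form {n} r
... | q , refl = identity (+ q) (+ t q) (sumUpTo-nthEvil-even (suc (q ℕ.+ q))) (cong +_ (sumTo-t-double+1 q))
                   (tℤ-double+1 q) (trans (cong +_ (t-double (suc (q ℕ.+ q)))) (tℤ-double+1 q))
  where
  identity : ∀ Q U {X T w ν} → let M = 1ℤ + (Q + Q) ; N = M + M in
    X ≡ T + M * (1ℤ + M) - w * (1ℤ + (M + M)) → T ≡ 1ℤ + Q → w ≡ 1ℤ - U → ν ≡ 1ℤ - U →
    + 4 * X ≡ N * N + + 3 * N + + 2 - + 4 * (N + + 1) * ν
  identity Q U refl refl refl refl = ℤ-Solver.solve (Q ∷ U ∷ [])

sumUpTo-nthEvil-4q+3 : ∀ n → n % 4 ≡ 3 →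
  + 4 * + sumUpTo nthEvil n ≡ + n * + n + + n
sumUpTo-nthEvil-4q+3 n r with 4q+3-form {n} r
... | q , refl = identity (+ q) (sumUpTo-nthEvil-odd (suc (q ℕ.+ q))) (cong +_ (sumTo-t-double+1 q))
  where
  identity : ∀ Q {X T} → let M = 1ℤ + (Q + Q) ; N = 1ℤ + (M + M) in
    X ≡ T + M * (1ℤ + M) → T ≡ 1ℤ + Q →
    + 4 * X ≡ N * N + N
  identity Q refl refl = ℤ-Solver.solve (Q ∷ [])

module _ {a b : ℕ → ℕ} (ea : IsIncreasingEnumeration Odious a) (eb : IsIncreasingEnumeration Evil b) where

  private
    sumTo-a : ∀ N → sumTo N a ≡ sumTo N nthOdious
    sumTo-a N = sumTo-cong N (λ {k} _ → odious-enumeration ea k)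

    sumTo-b : ∀ N → sumTo N b ≡ sumTo N nthEvil
    sumTo-b N = sumTo-cong N (λ {k} _ → evil-enumeration eb k)

  sumTo-odious-upTo-evil : ∀ n → + sumTo (b n) a ≡ + b n * + b n + + b n + + n + + 1
  sumTo-odious-upTo-evil n rewrite evil-enumeration eb n =
    trans (cong +_ (trans (sumTo-a (nthEvil n)) (sumTo-nthOdious-upTo-nthEvil n)))
          (cong (λ S → S + + nthEvil n + + n + + 1) (pos-* (nthEvil n) (nthEvil n)))

  sumTo-evil-upTo-odious : ∀ n → + sumTo (a n) b ≡ + a n * + a n + + a n + + n + + 1
  sumTo-evil-upTo-odious n rewrite odious-enumeration ea n =
    trans (cong +_ (trans (sumTo-b (nthOdious n)) (sumTo-nthEvil-upTo-nthOdious n)))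
          (cong (λ S → S + + nthOdious n + + n + + 1) (pos-* (nthOdious n) (nthOdious n)))

  sumTo-odious-upTo-odious : ∀ n → + sumTo (a n) a ≡ + a n * + a n + + 2 * + a n - + n
  sumTo-odious-upTo-odious n rewrite odious-enumeration ea n =
    trans (+-moved (trans (cong (ℕ._+ n) (sumTo-a (nthOdious n))) (sumTo-nthOdious-upTo-nthOdious n)))
          (cong (_- + n) (cong₂ _+_ (pos-* (nthOdious n) (nthOdious n)) (pos-* 2 (nthOdious n))))

  sumTo-evil-upTo-evil : ∀ n → + sumTo (b n) b ≡ + b n * + b n + + 2 * + b n - + n
  sumTo-evil-upTo-evil n rewrite evil-enumeration eb n =
    trans (+-moved (trans (cong (ℕ._+ n) (sumTo-b (nthEvil n))) (sumTo-nthEvil-upTo-nthEvil n)))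
          (cong (_- + n) (cong₂ _+_ (pos-* (nthEvil n) (nthEvil n)) (pos-* 2 (nthEvil n))))

corollary3p4 : (a b : ℕ → ℕ) → IsIncreasingEnumeration Odious a → IsIncreasingEnumeration Evil b →
  (∀ n → + sumTo (b n) a ≡ + b n * + b n + + b n + + n + + 1) ×
  (∀ n → + sumTo (a n) b ≡ + a n * + a n + + a n + + n + + 1) ×
  (∀ n → + sumTo (a n) a ≡ + a n * + a n + + 2 * + a n - + n) ×
  (∀ n → + sumTo (b n) b ≡ + b n * + b n + + 2 * + b n - + n) ×
  (∀ n → (n % 4 ≡ 0 → + 4 * + sumUpTo a n ≡ + n * + n - + n + + 4 * + n * + t n) ×
         (n % 4 ≡ 1 → + 4 * + sumUpTo a n ≡ + n * + n + + n - + 2 + + 4 * + t n) ×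
         (n % 4 ≡ 2 → + 4 * + sumUpTo a n ≡ + n * + n - + n - + 2 + + 4 * (+ n + + 1) * + t n) ×
         (n % 4 ≡ 3 → + 4 * + sumUpTo a n ≡ + n * + n + + n)) ×
  (∀ n → (n % 4 ≡ 0 → + 4 * + sumUpTo b n ≡ + n * + n + + 3 * + n - + 4 * + n * + t n) ×
         (n % 4 ≡ 1 → + 4 * + sumUpTo b n ≡ + n * + n + + n + + 2 - + 4 * + t n) ×
         (n % 4 ≡ 2 → + 4 * + sumUpTo b n ≡ + n * + n + + 3 * + n + + 2 - + 4 * (+ n + + 1) * + t n) ×
         (n % 4 ≡ 3 → + 4 * + sumUpTo b n ≡ + n * + n + + n))
corollary3p4 a b ea eb =
    sumTo-odious-upTo-evil ea eb , sumTo-evil-upTo-odious ea eb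
  , sumTo-odious-upTo-odious ea eb , sumTo-evil-upTo-evil ea eb
  , (λ n → via-a n ∘ sumUpTo-nthOdious-4q n , via-a n ∘ sumUpTo-nthOdious-4q+1 n
         , via-a n ∘ sumUpTo-nthOdious-4q+2 n , via-a n ∘ sumUpTo-nthOdious-4q+3 n)
  , (λ n → via-b n ∘ sumUpTo-nthEvil-4q n , via-b n ∘ sumUpTo-nthEvil-4q+1 n
         , via-b n ∘ sumUpTo-nthEvil-4q+2 n , via-b n ∘ sumUpTo-nthEvil-4q+3 n)
  where
  via-a : ∀ n {R} → + 4 * + sumUpTo nthOdious n ≡ R → + 4 * + sumUpTo a n ≡ R
  via-a n = trans (cong (λ X → + 4 * + X) (sumUpTo-cong (odious-enumeration ea) n))

  via-b : ∀ n {R} → + 4 * + sumUpTo nthEvil n ≡ R → + 4 * + sumUpTo b n ≡ R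
  via-b n = trans (cong (λ X → + 4 * + X) (sumUpTo-cong (evil-enumeration eb) n))
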